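{- For every positive integer $n$, \[ \sum_{\substack{a+b=n\\ a,b\ge 1}}\sigma(ab)\equiv 2(n^2-1)\pmod 5, \] where $\sigma$ is the sum-of-divisors function. In particular, the residues modulo $5$ of the left-hand side, for $n=1,2,3,\dots$, are periodic with period $5$: $0,1,1,0,3,0,1,1,0,3,\dots$ -}

module Defs where

open import Data.Nat using (ℕ; suc; _+_; _*_; _∸_)
open import Data.Nat.Divisibility using (_∣_; _∣?_)
open import Data.List using (List; filter; applyUpTo)
open import Data.Nat.ListAction using (sum)

-- divisors of n among 1..n (for n = 0 this is the empty list; σ is only
-- applied to positive arguments below)
divisors : ℕ → List ℕ
divisors n = filter (λ d → d ∣? n) (applyUpTo suc n)

σ : ℕ → ℕ
σ n = sum (divisors n)

S : ℕ → ℕ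
S n = sum (applyUpTo (λ i → σ (suc i * (n ∸ suc i))) (n ∸ 1))

{-# OPTIONS --safe #-}
-- Let T(n) = ∑ a b over the representations n = a x + b y with a, b, x, y ≥ 1. Skoruppa's elementary
-- argument gives 12 T(n) = 5 σ₃(n) + (1 − 6 n) σ(n): the shears (a, b; x, y) ↦ (a − b, b; x, x + y) and
-- (a, b − a; x + y, y) match the terms with a ≠ b against those with x ≠ y, and the diagonals a = b and
-- x = y are divisor sums. On the other hand T(n) = ∑ a y, and (a, b, x, y) ↦ (g, a x′ + b y′, a x′, a y′)
-- with g = gcd(x, y), x = g x′, y = g y′ is a bijection onto the (h, m, u, d) with h m = n, 0 < u < m,
-- d ∣ u (m − u), carrying a y to h d; hence T(n) = ∑_{h m = n} h S(m). Modulo 5 the first identity reads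
-- 2 T(n) ≡ (1 − n) σ(n). By strong induction S(m) ≡ 2 (m² − 1) for m < n, and since
-- ∑_{h m = n} h · 2 (m² − 1) = 2 n σ(n) − 2 σ(n), this leaves 2 S(n) ≡ 4 (n² − 1).
module Submission where

open import Defs
open import Data.Empty using (⊥-elim)
open import Data.List using (List; []; _∷_; _++_; _∷ʳ_; map; downFrom; applyUpTo; filter; cartesianProduct)
open import Data.List.Properties using (applyUpTo-∷ʳ)
open import Data.Nat
open import Data.Nat.Properties
open import Data.Nat.ListAction using (sum)
open import Data.Nat.DivMod using (_/_; m*n/n≡m; [m+kn]%n≡m%n)
open import Data.Nat.Divisibility
  using (_∣_; _∣?_; divides; quotient; quotient≢0; m∣n⇒n≡m*quotient; m∣n⇒n≡quotient*m; *-cancelˡ-∣; ∣⇒≤)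
open import Data.Nat.GCD using (gcd; gcd[m,n]∣m; gcd[m,n]∣n; gcd[m,n]≢0; c*gcd[m,n]≡gcd[cm,cn])
open import Data.Nat.Coprimality using (Coprime; gcd≡1⇒coprime; coprime⇒gcd≡1; coprime-divisor)
import Data.Nat.Coprimality as Coprime
open import Data.Sum using (inj₁)
open import Algebra.Properties.CommutativeSemigroup +-commutativeSemigroup using () renaming (interchange to +-interchange)
open import Algebra.Properties.CommutativeSemigroup *-commutativeSemigroup using () renaming (x∙yz≈y∙xz to *-left-swap)
open import Data.Nat.Tactic.RingSolver using (solve-∀)
open import Data.Nat.Induction using (<-rec)
open import Data.Product using (_×_; _,_; proj₁; proj₂; ∃₂; swap)
open import Data.Product.Properties using (≡-dec)
open import Function using (_∘_)
open import Level using (0ℓ)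
open import Relation.Binary.Bundles using (Setoid)
open import Relation.Binary.Definitions using (DecidableEquality; tri<; tri≈; tri>)
open import Relation.Binary.PropositionalEquality
open import Relation.Nullary using (Dec; yes; no; ¬_)
open import Relation.Nullary.Decidable using (_×-dec_)
open import Relation.Unary using (Pred; Decidable; _⊆_; _∩_)
open import Relation.Unary.Properties using (_∩?_)

private
  variable
    A B : Set

infixr 6.5 [_]·_

[_]·_ : {P : Set} → Dec P → ℕ → ℕ
[ yes _ ]· v = v
[ no _ ]· v = 0

∑ : List A → (A → ℕ) → ℕ
∑ [] f = 0
∑ (x ∷ xs) f = f x + ∑ xs f

infix 5 ∑
syntax ∑ xs (λ x → e) = ∑[ x ← xs ] e

[]·-+ : {P : Set} (d : Dec P) (u v : ℕ) → [ d ]· (u + v) ≡ [ d ]· u + [ d ]· v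
[]·-+ (yes _) u v = refl
[]·-+ (no _) u v = refl

[]·-* : {P : Set} (d : Dec P) (c v : ℕ) → [ d ]· (c * v) ≡ c * ([ d ]· v)
[]·-* (yes _) c v = refl
[]·-* (no _) c v = sym (*-zeroʳ c)

[]·-zero : {P : Set} (d : Dec P) → [ d ]· 0 ≡ 0
[]·-zero (yes _) = refl
[]·-zero (no _) = refl

[]·-×-dec : {P Q : Set} (d : Dec P) (e : Dec Q) (v : ℕ) → [ d ×-dec e ]· v ≡ [ d ]· [ e ]· v
[]·-×-dec (yes _) (yes _) v = refl
[]·-×-dec (yes _) (no _) v = refl
[]·-×-dec (no _) e v = refl

[]·-holds : {P : Set} (d : Dec P) {v : ℕ} → P → [ d ]· v ≡ v
[]·-holds (yes _) p = refl
[]·-holds (no ¬p) p = ⊥-elim (¬p p)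

[]·-fails : {P : Set} (d : Dec P) {v : ℕ} → ¬ P → [ d ]· v ≡ 0
[]·-fails (yes p) ¬p = ⊥-elim (¬p p)
[]·-fails (no _) ¬p = refl

[]·-cong : {P : Set} (d : Dec P) {u v : ℕ} → (P → u ≡ v) → [ d ]· u ≡ [ d ]· v
[]·-cong (yes p) e = e p
[]·-cong (no _) e = refl

[]·-trichotomy : (a b v : ℕ) → [ b <? a ]· v + [ a <? b ]· v + [ a ≟ b ]· v ≡ v
[]·-trichotomy a b v with <-cmp a b
... | tri< a<b a≢b b≮a
  rewrite []·-fails (b <? a) {v} b≮a | []·-holds (a <? b) {v} a<b | []·-fails (a ≟ b) {v} a≢b = +-identityʳ v
... | tri≈ a≮b a≡b b≮a
  rewrite []·-fails (b <? a) {v} b≮a | []·-fails (a <? b) {v} a≮b | []·-holds (a ≟ b) {v} a≡b = refl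
... | tri> a≮b a≢b b<a
  rewrite []·-holds (b <? a) {v} b<a | []·-fails (a <? b) {v} a≮b | []·-fails (a ≟ b) {v} a≢b =
  trans (+-identityʳ (v + 0)) (+-identityʳ v)

∑-cong : (xs : List A) {f g : A → ℕ} → (∀ x → f x ≡ g x) → ∑ xs f ≡ ∑ xs g
∑-cong [] e = refl
∑-cong (x ∷ xs) e = cong₂ _+_ (e x) (∑-cong xs e)

∑-zero : (xs : List A) → ∑[ x ← xs ] 0 ≡ 0
∑-zero [] = refl
∑-zero (x ∷ xs) = ∑-zero xs

∑-+ : (xs : List A) (f g : A → ℕ) → ∑[ x ← xs ] (f x + g x) ≡ ∑ xs f + ∑ xs g
∑-+ [] f g = refl
∑-+ (x ∷ xs) f g = begin
  f x + g x + (∑[ x ← xs ] (f x + g x)) ≡⟨ cong (f x + g x +_) (∑-+ xs f g) ⟩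
  f x + g x + (∑ xs f + ∑ xs g)       ≡⟨ +-interchange (f x) (g x) _ _ ⟩
  f x + ∑ xs f + (g x + ∑ xs g)       ∎
  where open ≡-Reasoning

∑-*ˡ : (xs : List A) (c : ℕ) (f : A → ℕ) → ∑[ x ← xs ] (c * f x) ≡ c * ∑ xs f
∑-*ˡ [] c f = sym (*-zeroʳ c)
∑-*ˡ (x ∷ xs) c f = trans (cong (c * f x +_) (∑-*ˡ xs c f)) (sym (*-distribˡ-+ c (f x) (∑ xs f)))

[]·-∑ : {P : Set} (d : Dec P) (xs : List A) (f : A → ℕ) → [ d ]· ∑ xs f ≡ ∑[ x ← xs ] [ d ]· f x
[]·-∑ (yes _) xs f = refl
[]·-∑ (no _) xs f = sym (∑-zero xs)

∑-++ : (xs ys : List A) (f : A → ℕ) → ∑ (xs ++ ys) f ≡ ∑ xs f + ∑ ys f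
∑-++ [] ys f = refl
∑-++ (x ∷ xs) ys f = trans (cong (f x +_) (∑-++ xs ys f)) (sym (+-assoc (f x) _ _))

∑-map : (g : A → B) (xs : List A) (f : B → ℕ) → ∑ (map g xs) f ≡ ∑[ x ← xs ] f (g x)
∑-map g [] f = refl
∑-map g (x ∷ xs) f = cong (f (g x) +_) (∑-map g xs f)

∑-comm : (xs : List A) (ys : List B) (f : A → B → ℕ) →
         ∑[ x ← xs ] ∑[ y ← ys ] f x y ≡ ∑[ y ← ys ] ∑[ x ← xs ] f x y
∑-comm [] ys f = sym (∑-zero ys)
∑-comm (x ∷ xs) ys f = trans (cong (∑ ys (f x) +_) (∑-comm xs ys f)) (sym (∑-+ ys (f x) _))

∑-cartesianProduct : (xs : List A) (ys : List B) (f : A × B → ℕ) →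
                     ∑ (cartesianProduct xs ys) f ≡ ∑[ x ← xs ] ∑[ y ← ys ] f (x , y)
∑-cartesianProduct [] ys f = refl
∑-cartesianProduct (x ∷ xs) ys f = trans (∑-++ (map (x ,_) ys) _ f)
  (cong₂ _+_ (∑-map (x ,_) ys f) (∑-cartesianProduct xs ys f))

module _ {R : Pred A 0ℓ} (xs : List A) (R? : Decidable R) where

  ∑-[]·-cong : {f g : A → ℕ} → (∀ {x} → R x → f x ≡ g x) →
               ∑[ x ← xs ] [ R? x ]· f x ≡ ∑[ x ← xs ] [ R? x ]· g x
  ∑-[]·-cong f≗g = ∑-cong xs (λ x → []·-cong (R? x) f≗g)

  ∑-[]·-+ : (f g : A → ℕ) → ∑[ x ← xs ] [ R? x ]· (f x + g x) ≡
            (∑[ x ← xs ] [ R? x ]· f x) + (∑[ x ← xs ] [ R? x ]· g x)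
  ∑-[]·-+ f g = trans (∑-cong xs (λ x → []·-+ (R? x) (f x) (g x))) (∑-+ xs _ _)

  ∑-[]·-*ˡ : (c : ℕ) (f : A → ℕ) → ∑[ x ← xs ] [ R? x ]· (c * f x) ≡ c * (∑[ x ← xs ] [ R? x ]· f x)
  ∑-[]·-*ˡ c f = trans (∑-cong xs (λ x → []·-* (R? x) c (f x))) (∑-*ˡ xs c _)

  ∑-trichotomy : (u v f : A → ℕ) →
    (∑[ x ← xs ] [ (R? ∩? λ y → v y <? u y) x ]· f x) + (∑[ x ← xs ] [ (R? ∩? λ y → u y <? v y) x ]· f x)
      + (∑[ x ← xs ] [ (R? ∩? λ y → u y ≟ v y) x ]· f x) ≡ ∑[ x ← xs ] [ R? x ]· f x
  ∑-trichotomy u v f = trans (cong (_+ ∑ xs f₌) (sym (∑-+ xs f₋ f₊))) (trans (sym (∑-+ xs (λ x → f₋ x + f₊ x) f₌))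
    (∑-cong xs λ x → begin
      [ R? x ×-dec v x <? u x ]· f x + [ R? x ×-dec u x <? v x ]· f x + [ R? x ×-dec u x ≟ v x ]· f x
        ≡⟨ cong₂ _+_ (cong₂ _+_ ([]·-×-dec (R? x) _ _) ([]·-×-dec (R? x) _ _)) ([]·-×-dec (R? x) _ _) ⟩
      [ R? x ]· [ v x <? u x ]· f x + [ R? x ]· [ u x <? v x ]· f x + [ R? x ]· [ u x ≟ v x ]· f x
        ≡⟨ cong (_+ [ R? x ]· [ u x ≟ v x ]· f x) ([]·-+ (R? x) _ _) ⟨
      [ R? x ]· ([ v x <? u x ]· f x + [ u x <? v x ]· f x) + [ R? x ]· [ u x ≟ v x ]· f x
        ≡⟨ []·-+ (R? x) _ _ ⟨
      [ R? x ]· ([ v x <? u x ]· f x + [ u x <? v x ]· f x + [ u x ≟ v x ]· f x)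
        ≡⟨ cong ([ R? x ]·_) ([]·-trichotomy (u x) (v x) (f x)) ⟩
      [ R? x ]· f x ∎))
    where
    open ≡-Reasoning
    f₋ f₊ f₌ : A → ℕ
    f₋ x = [ R? x ×-dec v x <? u x ]· f x
    f₊ x = [ R? x ×-dec u x <? v x ]· f x
    f₌ x = [ R? x ×-dec u x ≟ v x ]· f x

∑-downFrom-cong : (n : ℕ) {f g : ℕ → ℕ} → (∀ {i} → i < n → f i ≡ g i) → ∑ (downFrom n) f ≡ ∑ (downFrom n) g
∑-downFrom-cong zero e = refl
∑-downFrom-cong (suc n) e = cong₂ _+_ (e ≤-refl) (∑-downFrom-cong n (λ i<n → e (m<n⇒m<1+n i<n)))

∑-downFrom-const : (n v : ℕ) → ∑[ _ ← downFrom n ] v ≡ n * v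
∑-downFrom-const zero v = refl
∑-downFrom-const (suc n) v = cong (v +_) (∑-downFrom-const n v)

∑-downFrom-<-truncate : ∀ n m (f : ℕ → ℕ) → m ≤ n → ∑[ i ← downFrom n ] [ i <? m ]· f i ≡ ∑ (downFrom m) f
∑-downFrom-<-truncate zero .zero f z≤n = refl
∑-downFrom-<-truncate (suc n) m f m≤n with n <? m
... | no n≮m = ∑-downFrom-<-truncate n m f (≮⇒≥ n≮m)
... | yes n<m with refl ← ≤-antisym m≤n n<m =
  cong (f n +_) (∑-downFrom-cong n (λ i<n → []·-holds (_ <? suc n) (m<n⇒m<1+n i<n)))

∑-applyUpTo : (g : ℕ → A) (n : ℕ) (f : A → ℕ) → ∑ (applyUpTo g n) f ≡ ∑[ i ← downFrom n ] f (g i)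
∑-applyUpTo g zero f = refl
∑-applyUpTo g (suc n) f = begin
  ∑ (applyUpTo g (suc n)) f               ≡⟨ cong (λ l → ∑ l f) (applyUpTo-∷ʳ g n) ⟨
  ∑ (applyUpTo g n ∷ʳ g n) f              ≡⟨ ∑-++ (applyUpTo g n) _ f ⟩
  ∑ (applyUpTo g n) f + (f (g n) + 0)     ≡⟨ cong₂ _+_ (∑-applyUpTo g n f) (+-identityʳ _) ⟩
  (∑[ i ← downFrom n ] f (g i)) + f (g n) ≡⟨ +-comm _ (f (g n)) ⟩
  f (g n) + (∑[ i ← downFrom n ] f (g i)) ∎
  where open ≡-Reasoning

sum≡∑ : (xs : List ℕ) → sum xs ≡ ∑[ x ← xs ] x
sum≡∑ [] = refl
sum≡∑ (x ∷ xs) = cong (x +_) (sum≡∑ xs)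

sum-filter : {P : Pred ℕ _} (P? : Decidable P) (xs : List ℕ) → sum (filter P? xs) ≡ ∑[ x ← xs ] [ P? x ]· x
sum-filter P? [] = refl
sum-filter P? (x ∷ xs) with P? x
... | yes _ = cong (x +_) (sum-filter P? xs)
... | no _ = sum-filter P? xs

record Enumeration (A : Set) : Set₁ where
  field
    elements : List A
    decEq : DecidableEquality A
    Inside : Pred A 0ℓ
    ∑-δ : ∀ {c} → Inside c → ∀ v → ∑[ x ← elements ] [ decEq x c ]· v ≡ v

open Enumeration

∑-downFrom-δ-outside : ∀ n {c} → n ≤ c → ∀ v → ∑[ i ← downFrom n ] [ i ≟ c ]· v ≡ 0
∑-downFrom-δ-outside zero n≤c v = refl
∑-downFrom-δ-outside (suc n) {c} n<c v with n ≟ c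
... | yes refl = ⊥-elim (<-irrefl refl n<c)
... | no _ = ∑-downFrom-δ-outside n (<⇒≤ n<c) v

∑-downFrom-δ : ∀ n {c} → c < n → ∀ v → ∑[ i ← downFrom n ] [ i ≟ c ]· v ≡ v
∑-downFrom-δ (suc n) {c} c<1+n v with n ≟ c
... | yes refl = trans (cong (v +_) (∑-downFrom-δ-outside n ≤-refl v)) (+-identityʳ v)
... | no n≢c = ∑-downFrom-δ n (≤∧≢⇒< (≤-pred c<1+n) (n≢c ∘ sym)) v

downFromₑ : ℕ → Enumeration ℕ
downFromₑ n = record
  { elements = downFrom n ; decEq = _≟_ ; Inside = _< n ; ∑-δ = ∑-downFrom-δ n }

[]·-≡-dec : (dA : DecidableEquality A) (dB : DecidableEquality B) (a a′ : A) (b b′ : B) (v : ℕ) →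
            [ ≡-dec dA dB (a , b) (a′ , b′) ]· v ≡ [ dA a a′ ]· [ dB b b′ ]· v
[]·-≡-dec dA dB a a′ b b′ v with dA a a′
... | no _ = refl
... | yes refl with dB b b′
...   | yes _ = refl
...   | no _ = refl

infixr 2 _×ₑ_

_×ₑ_ : Enumeration A → Enumeration B → Enumeration (A × B)
EA ×ₑ EB = record
  { elements = cartesianProduct (elements EA) (elements EB)
  ; decEq = ≡-dec (decEq EA) (decEq EB)
  ; Inside = λ (a , b) → Inside EA a × Inside EB b
  ; ∑-δ = λ { {c₁ , c₂} (i₁ , i₂) v → begin
      ∑[ x ← cartesianProduct (elements EA) (elements EB) ] [ ≡-dec (decEq EA) (decEq EB) x (c₁ , c₂) ]· v
        ≡⟨ ∑-cartesianProduct (elements EA) (elements EB) _ ⟩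
      (∑[ a ← elements EA ] ∑[ b ← elements EB ] [ ≡-dec (decEq EA) (decEq EB) (a , b) (c₁ , c₂) ]· v)
        ≡⟨ ∑-cong (elements EA) (λ a → ∑-cong (elements EB) (λ b → []·-≡-dec (decEq EA) (decEq EB) a c₁ b c₂ v)) ⟩
      (∑[ a ← elements EA ] ∑[ b ← elements EB ] [ decEq EA a c₁ ]· [ decEq EB b c₂ ]· v)
        ≡⟨ ∑-cong (elements EA) (λ a → []·-∑ (decEq EA a c₁) (elements EB) _) ⟨
      (∑[ a ← elements EA ] [ decEq EA a c₁ ]· (∑[ b ← elements EB ] [ decEq EB b c₂ ]· v))
        ≡⟨ ∑-cong (elements EA) (λ a → cong ([ decEq EA a c₁ ]·_) (∑-δ EB i₂ v)) ⟩
      (∑[ a ← elements EA ] [ decEq EA a c₁ ]· v)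
        ≡⟨ ∑-δ EA i₁ v ⟩
      v ∎ }
  }
  where open ≡-Reasoning

record PartialBijection {X Y : Set} (P : Pred X 0ℓ) (Q : Pred Y 0ℓ) : Set where
  field
    to : X → Y
    from : Y → X
    to-∈ : ∀ {x} → P x → Q (to x)
    from-∈ : ∀ {y} → Q y → P (from y)
    from∘to : ∀ {x} → P x → from (to x) ≡ x
    to∘from : ∀ {y} → Q y → to (from y) ≡ y

-- Both sides equal ∑ over x and y of [P x] [y = to x] f x = [Q y] [x = from y] g y.
module _ {X Y : Set} (EX : Enumeration X) (EY : Enumeration Y)
         {P : Pred X 0ℓ} {Q : Pred Y 0ℓ} (P? : Decidable P) (Q? : Decidable Q)
         (P-inside : P ⊆ Inside EX) (Q-inside : Q ⊆ Inside EY) (b : PartialBijection P Q) where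
  open PartialBijection b

  ∑-reindex : (f : X → ℕ) (g : Y → ℕ) → (∀ {x} → P x → g (to x) ≡ f x) →
              ∑[ x ← elements EX ] [ P? x ]· f x ≡ ∑[ y ← elements EY ] [ Q? y ]· g y
  ∑-reindex f g g∘to≡f = begin
    (∑[ x ← xs ] [ P? x ]· f x)
      ≡⟨ ∑-cong xs (λ x → []·-cong (P? x) (λ p → sym (∑-δ EY (Q-inside (to-∈ p)) (f x)))) ⟩
    (∑[ x ← xs ] [ P? x ]· (∑[ y ← ys ] [ decEq EY y (to x) ]· f x))
      ≡⟨ ∑-cong xs (λ x → []·-∑ (P? x) ys _) ⟩
    (∑[ x ← xs ] ∑[ y ← ys ] [ P? x ]· [ decEq EY y (to x) ]· f x)
      ≡⟨ ∑-comm xs ys _ ⟩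
    (∑[ y ← ys ] ∑[ x ← xs ] [ P? x ]· [ decEq EY y (to x) ]· f x)
      ≡⟨ ∑-cong ys (λ y → ∑-cong xs (λ x → graph-symmetric x y)) ⟩
    (∑[ y ← ys ] ∑[ x ← xs ] [ Q? y ]· [ decEq EX x (from y) ]· g y)
      ≡⟨ ∑-cong ys (λ y → []·-∑ (Q? y) xs _) ⟨
    (∑[ y ← ys ] [ Q? y ]· (∑[ x ← xs ] [ decEq EX x (from y) ]· g y))
      ≡⟨ ∑-cong ys (λ y → []·-cong (Q? y) (λ q → ∑-δ EX (P-inside (from-∈ q)) (g y))) ⟩
    (∑[ y ← ys ] [ Q? y ]· g y) ∎
    where
    open ≡-Reasoning
    xs : List X
    ys : List Y
    xs = elements EX
    ys = elements EY
    graph-symmetric : ∀ x y → [ P? x ]· [ decEq EY y (to x) ]· f x ≡ [ Q? y ]· [ decEq EX x (from y) ]· g y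
    graph-symmetric x y with P? x | Q? y
    graph-symmetric x y | yes p | yes q with decEq EY y (to x) | decEq EX x (from y)
    ... | yes refl | yes _ = sym (g∘to≡f p)
    ... | yes refl | no x≢ = ⊥-elim (x≢ (sym (from∘to p)))
    ... | no y≢ | yes refl = ⊥-elim (y≢ (sym (to∘from q)))
    ... | no _ | no _ = refl
    graph-symmetric x y | yes p | no ¬q with decEq EY y (to x)
    ... | yes refl = ⊥-elim (¬q (to-∈ p))
    ... | no _ = refl
    graph-symmetric x y | no ¬p | yes q with decEq EX x (from y)
    ... | yes refl = ⊥-elim (¬p (from-∈ q))
    ... | no _ = refl
    graph-symmetric x y | no _ | no _ = refl

  ∑-reindex-from : (f : X → ℕ) → ∑[ x ← elements EX ] [ P? x ]· f x ≡ ∑[ y ← elements EY ] [ Q? y ]· f (from y)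
  ∑-reindex-from f = ∑-reindex f (f ∘ from) (cong f ∘ from∘to)

2*∑suc : ∀ m → 2 * (∑[ u ← downFrom m ] suc u) ≡ m * suc m
2*∑suc zero = refl
2*∑suc (suc m) = begin
  2 * (suc m + (∑[ u ← downFrom m ] suc u))     ≡⟨ *-distribˡ-+ 2 (suc m) _ ⟩
  2 * suc m + 2 * (∑[ u ← downFrom m ] suc u)   ≡⟨ cong (2 * suc m +_) (2*∑suc m) ⟩
  2 * suc m + m * suc m                          ≡⟨ identity m ⟩
  suc m * suc (suc m)                            ∎
  where
  open ≡-Reasoning
  identity : ∀ m → 2 * suc m + m * suc m ≡ suc m * suc (suc m)
  identity = solve-∀

∑suc*∸-suc : ∀ m → ∑[ u ← downFrom (suc m) ] suc u * (suc m ∸ u) ≡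
                   suc m + ((∑[ u ← downFrom m ] suc u * (m ∸ u)) + (∑[ u ← downFrom m ] suc u))
∑suc*∸-suc m = cong₂ _+_ (trans (cong (suc m *_) (m+n∸n≡m 1 m)) (*-identityʳ (suc m)))
  (trans (∑-downFrom-cong m step) (∑-+ (downFrom m) _ _))
  where
  step : ∀ {u} → u < m → suc u * (suc m ∸ u) ≡ suc u * (m ∸ u) + suc u
  step {u} u<m = trans (cong (suc u *_) (+-∸-assoc 1 (<⇒≤ u<m)))
                       (trans (*-suc (suc u) (m ∸ u)) (+-comm (suc u) _))

6*∑suc*∸ : ∀ m → 6 * (∑[ u ← downFrom m ] suc u * (m ∸ u)) ≡ m * suc m * suc (suc m)
6*∑suc*∸ zero = refl
6*∑suc*∸ (suc m) = begin
  6 * (∑[ u ← downFrom (suc m) ] suc u * (suc m ∸ u))   ≡⟨ cong (6 *_) (∑suc*∸-suc m) ⟩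
  6 * (suc m + (c + t))                                  ≡⟨ regroup (suc m) c t ⟩
  6 * suc m + 6 * c + 3 * (2 * t)                        ≡⟨ cong₂ (λ x y → 6 * suc m + x + 3 * y) (6*∑suc*∸ m) (2*∑suc m) ⟩
  6 * suc m + m * suc m * suc (suc m) + 3 * (m * suc m)  ≡⟨ identity m ⟩
  suc m * suc (suc m) * suc (suc (suc m))                ∎
  where
  open ≡-Reasoning
  c t : ℕ
  c = ∑[ u ← downFrom m ] suc u * (m ∸ u)
  t = ∑[ u ← downFrom m ] suc u
  regroup : ∀ s c t → 6 * (s + (c + t)) ≡ 6 * s + 6 * c + 3 * (2 * t)
  regroup = solve-∀
  identity : ∀ m → 6 * suc m + m * suc m * suc (suc m) + 3 * (m * suc m) ≡ suc m * suc (suc m) * suc (suc (suc m))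
  identity = solve-∀

quadratic : ℕ → ℕ → ℕ
quadratic A B = A * A + A * B + B * B

-- quadratic A B + A B = (A + B)², so this reduces to 6*∑suc*∸.
6*∑quadratic : ∀ m → 6 * (∑[ u ← downFrom m ] quadratic (suc u) (m ∸ u)) + 6 * (suc m * suc m) ≡
                     5 * (suc m * suc m * suc m) + suc m
6*∑quadratic m = +-cancelʳ-≡ (6 * c) _ _ (begin
  6 * w + 6 * (suc m * suc m) + 6 * c                        ≡⟨ regroup w c (suc m * suc m) ⟩
  6 * (w + c) + 6 * (suc m * suc m)                          ≡⟨ cong (λ z → 6 * z + 6 * (suc m * suc m)) w+c≡ ⟩
  6 * (m * (suc m * suc m)) + 6 * (suc m * suc m)            ≡⟨ identity m ⟩
  5 * (suc m * suc m * suc m) + suc m + m * suc m * suc (suc m) ≡⟨ cong (5 * (suc m * suc m * suc m) + suc m +_) (6*∑suc*∸ m) ⟨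
  5 * (suc m * suc m * suc m) + suc m + 6 * c                ∎)
  where
  open ≡-Reasoning
  w c : ℕ
  w = ∑[ u ← downFrom m ] quadratic (suc u) (m ∸ u)
  c = ∑[ u ← downFrom m ] suc u * (m ∸ u)
  square-step : ∀ {u} → u < m → quadratic (suc u) (m ∸ u) + suc u * (m ∸ u) ≡ suc m * suc m
  square-step {u} u<m = trans (square (suc u) (m ∸ u)) (cong (λ z → suc z * suc z) (m+[n∸m]≡n (<⇒≤ u<m)))
    where
    square : ∀ A B → A * A + A * B + B * B + A * B ≡ (A + B) * (A + B)
    square = solve-∀
  w+c≡ : w + c ≡ m * (suc m * suc m)
  w+c≡ = trans (sym (∑-+ (downFrom m) _ _)) (trans (∑-downFrom-cong m square-step) (∑-downFrom-const m _))
  regroup : ∀ w c s → 6 * w + 6 * s + 6 * c ≡ 6 * (w + c) + 6 * s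
  regroup = solve-∀
  identity : ∀ m → 6 * (m * (suc m * suc m)) + 6 * (suc m * suc m) ≡
                   5 * (suc m * suc m * suc m) + suc m + m * suc m * suc (suc m)
  identity = solve-∀

σ≡∑ : ∀ k N .{{_ : NonZero k}} → k ≤ N → σ k ≡ ∑[ j ← downFrom N ] [ suc j ∣? k ]· suc j
σ≡∑ k N k≤N = begin
  σ k                                                    ≡⟨ sum-filter (_∣? k) (applyUpTo suc k) ⟩
  (∑[ d ← applyUpTo suc k ] [ d ∣? k ]· d)               ≡⟨ ∑-applyUpTo suc k _ ⟩
  (∑[ j ← downFrom k ] [ suc j ∣? k ]· suc j)            ≡⟨ ∑-downFrom-<-truncate N k _ k≤N ⟨
  (∑[ j ← downFrom N ] [ j <? k ]· [ suc j ∣? k ]· suc j) ≡⟨ ∑-cong (downFrom N) divisor-below ⟩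
  (∑[ j ← downFrom N ] [ suc j ∣? k ]· suc j)            ∎
  where
  open ≡-Reasoning
  divisor-below : ∀ j → [ j <? k ]· [ suc j ∣? k ]· suc j ≡ [ suc j ∣? k ]· suc j
  divisor-below j with suc j ∣? k
  ... | no _ = []·-zero (j <? k)
  ... | yes j+1∣k = []·-holds (j <? k) (∣⇒≤ j+1∣k)

S≡∑ : ∀ m → S (suc m) ≡ ∑[ u ← downFrom m ] σ (suc u * (m ∸ u))
S≡∑ m = trans (sum≡∑ (applyUpTo summand m)) (∑-applyUpTo summand m (λ s → s))
  where
  summand : ℕ → ℕ
  summand u = σ (suc u * (m ∸ u))

infix 4 _≡_mod_

_≡_mod_ : ℕ → ℕ → ℕ → Set
_≡_mod_ a b m = ∃₂ λ i j → a + i * m ≡ b + j * m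

module _ {m : ℕ} where

  ≡⇒≡-mod : ∀ {a b} → a ≡ b → a ≡ b mod m
  ≡⇒≡-mod a≡b = 0 , 0 , cong (_+ 0) a≡b

  ≡-mod-sym : ∀ {a b} → a ≡ b mod m → b ≡ a mod m
  ≡-mod-sym (i , j , e) = j , i , sym e

  ≡-mod-trans : ∀ {a b c} → a ≡ b mod m → b ≡ c mod m → a ≡ c mod m
  ≡-mod-trans {a} {b} {c} (i , j , e) (k , l , e′) = i + k , j + l , (begin
    a + (i + k) * m         ≡⟨ regroup a i k m ⟩
    a + i * m + k * m       ≡⟨ cong (_+ k * m) e ⟩
    b + j * m + k * m       ≡⟨ regroup′ b j k m ⟩
    b + k * m + j * m       ≡⟨ cong (_+ j * m) e′ ⟩
    c + l * m + j * m       ≡⟨ regroup″ c l j m ⟩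
    c + (j + l) * m         ∎)
    where
    open ≡-Reasoning
    regroup : ∀ a i k m → a + (i + k) * m ≡ a + i * m + k * m
    regroup = solve-∀
    regroup′ : ∀ b j k m → b + j * m + k * m ≡ b + k * m + j * m
    regroup′ = solve-∀
    regroup″ : ∀ c l j m → c + l * m + j * m ≡ c + (j + l) * m
    regroup″ = solve-∀

  +-mod-cong : ∀ {a b c d} → a ≡ b mod m → c ≡ d mod m → a + c ≡ b + d mod m
  +-mod-cong {a} {b} {c} {d} (i , j , e) (k , l , e′) = i + k , j + l ,
    trans (regroup a c i k m) (trans (cong₂ _+_ e e′) (sym (regroup b d j l m)))
    where
    regroup : ∀ a c i k m → a + c + (i + k) * m ≡ (a + i * m) + (c + k * m)
    regroup = solve-∀

  *-mod-congˡ : ∀ c {a b} → a ≡ b mod m → c * a ≡ c * b mod m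
  *-mod-congˡ c {a} {b} (i , j , e) = c * i , c * j ,
    trans (regroup c a i m) (trans (cong (c *_) e) (sym (regroup c b j m)))
    where
    regroup : ∀ c a i m → c * a + c * i * m ≡ c * (a + i * m)
    regroup = solve-∀

  +-*-mod : ∀ a k → a + k * m ≡ a mod m
  +-*-mod a k = 0 , k , +-identityʳ _

  *-mod-cancelˡ : ∀ c d k {a b} → d * c ≡ 1 + k * m → c * a ≡ c * b mod m → a ≡ b mod m
  *-mod-cancelˡ c d k {a} {b} dc≡1 ca≡cb = ≡-mod-trans (≡-mod-sym (absorb a))
    (≡-mod-trans (*-mod-congˡ d ca≡cb) (absorb b))
    where
    absorb : ∀ x → d * (c * x) ≡ x mod m
    absorb x = ≡-mod-trans (≡⇒≡-mod (trans (sym (*-assoc d c x)) (trans (cong (_* x) dc≡1) (identity x k m))))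
                            (+-*-mod x (x * k))
      where
      identity : ∀ x k m → (1 + k * m) * x ≡ x + x * k * m
      identity = solve-∀

  ≡-mod⇒%≡ : .{{_ : NonZero m}} → ∀ {a b} → a ≡ b mod m → a % m ≡ b % m
  ≡-mod⇒%≡ {a} {b} (i , j , e) = trans (sym ([m+kn]%n≡m%n a i m)) (trans (cong (_% m) e) ([m+kn]%n≡m%n b j m))

  ≡-mod-setoid : Setoid 0ℓ 0ℓ
  ≡-mod-setoid = record
    { Carrier = ℕ ; _≈_ = _≡_mod m
    ; isEquivalence = record { refl = ≡⇒≡-mod refl ; sym = ≡-mod-sym ; trans = ≡-mod-trans } }

  ∑-mod-cong : (xs : List A) {f g : A → ℕ} → (∀ x → f x ≡ g x mod m) → ∑ xs f ≡ ∑ xs g mod m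
  ∑-mod-cong [] _ = ≡⇒≡-mod refl
  ∑-mod-cong (x ∷ xs) f≡g = +-mod-cong (f≡g x) (∑-mod-cong xs f≡g)

reduceˡ reduceʳ : ℕ → ℕ → ℕ
reduceˡ X Y = quotient (gcd[m,n]∣m X Y)
reduceʳ X Y = quotient (gcd[m,n]∣n X Y)

gcd*reduceˡ : ∀ X Y → gcd X Y * reduceˡ X Y ≡ X
gcd*reduceˡ X Y = sym (m∣n⇒n≡m*quotient (gcd[m,n]∣m X Y))

gcd*reduceʳ : ∀ X Y → gcd X Y * reduceʳ X Y ≡ Y
gcd*reduceʳ X Y = sym (m∣n⇒n≡m*quotient (gcd[m,n]∣n X Y))

module _ (X Y : ℕ) .{{_ : NonZero X}} where

  gcd-nonZero : NonZero (gcd X Y)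
  gcd-nonZero = ≢-nonZero (gcd[m,n]≢0 X Y (inj₁ (≢-nonZero⁻¹ X)))

  reduceˡ-nonZero : NonZero (reduceˡ X Y)
  reduceˡ-nonZero = quotient≢0 (gcd[m,n]∣m X Y)

  reduce-coprime : Coprime (reduceˡ X Y) (reduceʳ X Y)
  reduce-coprime = gcd≡1⇒coprime (*-cancelˡ-≡ _ 1 (gcd X Y) {{gcd-nonZero}} (begin
    gcd X Y * gcd (reduceˡ X Y) (reduceʳ X Y)          ≡⟨ c*gcd[m,n]≡gcd[cm,cn] (gcd X Y) _ _ ⟩
    gcd (gcd X Y * reduceˡ X Y) (gcd X Y * reduceʳ X Y) ≡⟨ cong₂ gcd (gcd*reduceˡ X Y) (gcd*reduceʳ X Y) ⟩
    gcd X Y                                             ≡⟨ *-identityʳ (gcd X Y) ⟨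
    gcd X Y * 1                                         ∎))
    where open ≡-Reasoning

reduceʳ-nonZero : ∀ X Y .{{_ : NonZero Y}} → NonZero (reduceʳ X Y)
reduceʳ-nonZero X Y = quotient≢0 (gcd[m,n]∣n X Y)

module _ (c : ℕ) {x y : ℕ} (x⊥y : Coprime x y) where

  gcd-*-coprime : gcd (c * x) (c * y) ≡ c
  gcd-*-coprime = trans (sym (c*gcd[m,n]≡gcd[cm,cn] c x y)) (trans (cong (c *_) (coprime⇒gcd≡1 x⊥y)) (*-identityʳ c))

  reduceˡ-*-coprime : .{{NonZero c}} → reduceˡ (c * x) (c * y) ≡ x
  reduceˡ-*-coprime = *-cancelˡ-≡ _ x c
    (trans (cong (_* reduceˡ (c * x) (c * y)) (sym gcd-*-coprime)) (gcd*reduceˡ (c * x) (c * y)))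

  reduceʳ-*-coprime : .{{NonZero c}} → reduceʳ (c * x) (c * y) ≡ y
  reduceʳ-*-coprime = *-cancelˡ-≡ _ y c
    (trans (cong (_* reduceʳ (c * x) (c * y)) (sym gcd-*-coprime)) (gcd*reduceʳ (c * x) (c * y)))

-- Exact division, with the junk value 0 for the divisor 0.
_÷_ : ℕ → ℕ → ℕ
m ÷ zero = 0
m ÷ suc d = m / suc d

*-÷ : ∀ c d .{{_ : NonZero d}} → (c * d) ÷ d ≡ c
*-÷ c (suc d) = m*n/n≡m c (suc d)

-- Tuples of positive integers are stored with every entry decreased by one, so that the entries of
-- those relevant for n range over downFrom n: the quadruple (a , b , x , y) stands for (a + 1 , b + 1 , x + 1 , y + 1).
Quad : Set
Quad = ℕ × ℕ × ℕ × ℕ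

Triple : Set
Triple = ℕ × ℕ × ℕ

raise₄ lower₄ : Quad → Quad
raise₄ (a , b , x , y) = suc a , suc b , suc x , suc y
lower₄ (A , B , X , Y) = pred A , pred B , pred X , pred Y

raise₃₁ lower₃₁ : Triple × ℕ → Triple × ℕ
raise₃₁ ((h , m , u) , d) = (suc h , suc m , suc u) , suc d
lower₃₁ ((H , M , U) , D) = (pred H , pred M , pred U) , pred D

raise∘lower₄ : ∀ {A B X Y} .{{_ : NonZero A}} .{{_ : NonZero B}} .{{_ : NonZero X}} .{{_ : NonZero Y}} →
               raise₄ (lower₄ (A , B , X , Y)) ≡ (A , B , X , Y)
raise∘lower₄ {A} {B} {X} {Y} = cong₂ _,_ (suc-pred A) (cong₂ _,_ (suc-pred B) (cong₂ _,_ (suc-pred X) (suc-pred Y)))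

raise∘lower₃₁ : ∀ {H M U D} .{{_ : NonZero H}} .{{_ : NonZero M}} .{{_ : NonZero U}} .{{_ : NonZero D}} →
                raise₃₁ (lower₃₁ ((H , M , U) , D)) ≡ ((H , M , U) , D)
raise∘lower₃₁ {H} {M} {U} {D} = cong₂ _,_ (cong₂ _,_ (suc-pred H) (cong₂ _,_ (suc-pred M) (suc-pred U))) (suc-pred D)

Φ : Quad → Triple × ℕ
Φ (A , B , X , Y) = (gcd X Y , A * reduceˡ X Y + B * reduceʳ X Y , A * reduceˡ X Y) , A * reduceʳ X Y

Ψ : Triple × ℕ → Quad
Ψ ((H , M , U) , D) = gcd U D , (M ∸ U) ÷ reduceʳ U D , H * reduceˡ U D , H * reduceʳ U D

module _ {A B X Y : ℕ} .{{_ : NonZero A}} .{{_ : NonZero B}} .{{_ : NonZero X}} .{{_ : NonZero Y}} where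
  private
    g X′ Y′ : ℕ
    g = gcd X Y
    X′ = reduceˡ X Y
    Y′ = reduceʳ X Y
    instance
      X′-nonZero : NonZero X′
      X′-nonZero = reduceˡ-nonZero X Y
      Y′-nonZero : NonZero Y′
      Y′-nonZero = reduceʳ-nonZero X Y

  Φ-product : g * (A * X′ + B * Y′) ≡ A * X + B * Y
  Φ-product = trans (identity g A B X′ Y′) (cong₂ (λ s t → A * s + B * t) (gcd*reduceˡ X Y) (gcd*reduceʳ X Y))
    where
    identity : ∀ g A B X′ Y′ → g * (A * X′ + B * Y′) ≡ A * (g * X′) + B * (g * Y′)
    identity = solve-∀

  Φ-< : A * X′ < A * X′ + B * Y′
  Φ-< = m<m+n (A * X′) (>-nonZero⁻¹ (B * Y′) {{m*n≢0 B Y′}})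

  Φ-∣ : A * Y′ ∣ A * X′ * (A * X′ + B * Y′ ∸ A * X′)
  Φ-∣ = divides (X′ * B) (trans (cong (A * X′ *_) (m+n∸m≡n (A * X′) (B * Y′))) (identity A B X′ Y′))
    where
    identity : ∀ A B X′ Y′ → A * X′ * (B * Y′) ≡ X′ * B * (A * Y′)
    identity = solve-∀

  Φ-positive : raise₃₁ (lower₃₁ (Φ (A , B , X , Y))) ≡ Φ (A , B , X , Y)
  Φ-positive = raise∘lower₃₁ {{gcd-nonZero X Y}} {{>-nonZero (≤-<-trans z≤n Φ-<)}} {{m*n≢0 A X′}} {{m*n≢0 A Y′}}

  Ψ∘Φ : Ψ (Φ (A , B , X , Y)) ≡ (A , B , X , Y)
  Ψ∘Φ = cong₂ _,_ (gcd-*-coprime A X′⊥Y′) (cong₂ _,_ B≡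
          (cong₂ _,_ (trans (cong (g *_) (reduceˡ-*-coprime A X′⊥Y′)) (gcd*reduceˡ X Y))
                     (trans (cong (g *_) (reduceʳ-*-coprime A X′⊥Y′)) (gcd*reduceʳ X Y))))
    where
    X′⊥Y′ : Coprime X′ Y′
    X′⊥Y′ = reduce-coprime X Y
    B≡ : (A * X′ + B * Y′ ∸ A * X′) ÷ reduceʳ (A * X′) (A * Y′) ≡ B
    B≡ = trans (cong₂ _÷_ (m+n∸m≡n (A * X′) (B * Y′)) (reduceʳ-*-coprime A X′⊥Y′)) (*-÷ B Y′)

module _ {H M U D : ℕ} .{{_ : NonZero H}} .{{_ : NonZero U}} .{{_ : NonZero D}}
         (U<M : U < M) (D∣ : D ∣ U * (M ∸ U)) where
  private
    p U′ D′ : ℕ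
    p = gcd U D
    U′ = reduceˡ U D
    D′ = reduceʳ U D
    U′⊥D′ : Coprime U′ D′
    U′⊥D′ = reduce-coprime U D
    instance
      p-nonZero : NonZero p
      p-nonZero = gcd-nonZero U D
      U′-nonZero : NonZero U′
      U′-nonZero = reduceˡ-nonZero U D
      D′-nonZero : NonZero D′
      D′-nonZero = reduceʳ-nonZero U D

    D′∣M∸U : D′ ∣ M ∸ U
    D′∣M∸U = coprime-divisor (Coprime.sym U′⊥D′) (*-cancelˡ-∣ p (subst₂ _∣_ (sym (gcd*reduceʳ U D))
               (trans (cong (_* (M ∸ U)) (sym (gcd*reduceˡ U D))) (*-assoc p U′ (M ∸ U))) D∣))

    c : ℕ
    c = quotient D′∣M∸U

    M∸U≡c*D′ : M ∸ U ≡ c * D′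
    M∸U≡c*D′ = m∣n⇒n≡quotient*m D′∣M∸U

    ÷≡c : (M ∸ U) ÷ D′ ≡ c
    ÷≡c = trans (cong (_÷ D′) M∸U≡c*D′) (*-÷ c D′)

    p*U′+c*D′≡M : p * U′ + c * D′ ≡ M
    p*U′+c*D′≡M = trans (cong₂ _+_ (gcd*reduceˡ U D) (sym M∸U≡c*D′)) (m+[n∸m]≡n (<⇒≤ U<M))

  Ψ-product : p * (H * U′) + (M ∸ U) ÷ D′ * (H * D′) ≡ H * M
  Ψ-product = begin
    p * (H * U′) + (M ∸ U) ÷ D′ * (H * D′) ≡⟨ cong (λ b → p * (H * U′) + b * (H * D′)) ÷≡c ⟩
    p * (H * U′) + c * (H * D′)            ≡⟨ identity H p c U′ D′ ⟩
    H * (p * U′ + c * D′)                  ≡⟨ cong (H *_) p*U′+c*D′≡M ⟩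
    H * M                                  ∎
    where
    open ≡-Reasoning
    identity : ∀ H p c U′ D′ → p * (H * U′) + c * (H * D′) ≡ H * (p * U′ + c * D′)
    identity = solve-∀

  Ψ-positive : raise₄ (lower₄ (Ψ ((H , M , U) , D))) ≡ Ψ ((H , M , U) , D)
  Ψ-positive = raise∘lower₄ {{p-nonZero}} {{÷-nonZero}} {{m*n≢0 H U′}} {{m*n≢0 H D′}}
    where
    ÷-nonZero : NonZero ((M ∸ U) ÷ D′)
    ÷-nonZero = ≢-nonZero λ c≡0 → m>n⇒m∸n≢0 U<M (trans M∸U≡c*D′ (cong (_* D′) (trans (sym ÷≡c) c≡0)))

  Φ∘Ψ : Φ (Ψ ((H , M , U) , D)) ≡ ((H , M , U) , D)
  Φ∘Ψ = cong₂ _,_ (cong₂ _,_ (gcd-*-coprime H U′⊥D′) (cong₂ _,_ M≡ U≡)) D≡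
    where
    U″≡U′ : reduceˡ (H * U′) (H * D′) ≡ U′
    U″≡U′ = reduceˡ-*-coprime H U′⊥D′
    D″≡D′ : reduceʳ (H * U′) (H * D′) ≡ D′
    D″≡D′ = reduceʳ-*-coprime H U′⊥D′
    U≡ : p * reduceˡ (H * U′) (H * D′) ≡ U
    U≡ = trans (cong (p *_) U″≡U′) (gcd*reduceˡ U D)
    D≡ : p * reduceʳ (H * U′) (H * D′) ≡ D
    D≡ = trans (cong (p *_) D″≡D′) (gcd*reduceʳ U D)
    M≡ : p * reduceˡ (H * U′) (H * D′) + (M ∸ U) ÷ D′ * reduceʳ (H * U′) (H * D′) ≡ M
    M≡ = trans (cong₂ (λ s t → p * s + t) U″≡U′ (cong₂ _*_ ÷≡c D″≡D′)) p*U′+c*D′≡M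

quads : ℕ → Enumeration Quad
quads n = downFromₑ n ×ₑ downFromₑ n ×ₑ downFromₑ n ×ₑ downFromₑ n

B<A A<B A≡B Y<X X<Y X≡Y : Pred Quad 0ℓ
B<A (a , b , _ , _) = b < a
A<B (a , b , _ , _) = a < b
A≡B (a , b , _ , _) = a ≡ b
Y<X (_ , _ , x , y) = y < x
X<Y (_ , _ , x , y) = x < y
X≡Y (_ , _ , x , y) = x ≡ y

b<a? : Decidable B<A
b<a? (a , b , _ , _) = b <? a
a<b? : Decidable A<B
a<b? (a , b , _ , _) = a <? b
a≟b? : Decidable A≡B
a≟b? (a , b , _ , _) = a ≟ b
y<x? : Decidable Y<X
y<x? (_ , _ , x , y) = y <? x
x<y? : Decidable X<Y
x<y? (_ , _ , x , y) = x <? y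
x≟y? : Decidable X≡Y
x≟y? (_ , _ , x , y) = x ≟ y

qab ab ay : Quad → ℕ
qab (a , b , _ , _) = quadratic (suc a) (suc b)
ab (a , b , _ , _) = suc a * suc b
ay (a , _ , _ , y) = suc a * suc y

closedForm : ℕ → ℕ
closedForm M = 2 * (M * M ∸ 1)

module Representations (n : ℕ) where

  Rep : Pred Quad 0ℓ
  Rep (a , b , x , y) = suc a * suc x + suc b * suc y ≡ n

  rep? : Decidable Rep
  rep? (a , b , x , y) = suc a * suc x + suc b * suc y ≟ n

  Rep⊆Inside : Rep ⊆ Inside (quads n)
  Rep⊆Inside {a , b , x , y} ax+by≡n =
      ≤-trans (m≤m+n (suc a) (suc b)) a+b≤n , ≤-trans (m≤n+m (suc b) (suc a)) a+b≤n
    , ≤-trans (m≤m+n (suc x) (suc y)) x+y≤n , ≤-trans (m≤n+m (suc y) (suc x)) x+y≤n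
    where
    a+b≤n : suc a + suc b ≤ n
    a+b≤n = ≤-trans (+-mono-≤ (m≤m*n (suc a) (suc x)) (m≤m*n (suc b) (suc y))) (≤-reflexive ax+by≡n)
    x+y≤n : suc x + suc y ≤ n
    x+y≤n = ≤-trans (+-mono-≤ (m≤n*m (suc x) (suc a)) (m≤n*m (suc y) (suc b))) (≤-reflexive ax+by≡n)

  ∑Quad : {R : Pred Quad 0ℓ} → Decidable R → (Quad → ℕ) → ℕ
  ∑Quad R? f = ∑[ q ← elements (quads n) ] [ R? q ]· f q

  shear₁ shear₁⁻¹ shear₂ shear₂⁻¹ : Quad → Quad
  shear₁ (a , b , x , y) = (a ∸ suc b , b , x , x + suc y)
  shear₁⁻¹ (a , b , x , y) = (a + suc b , b , x , y ∸ suc x)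
  shear₂ (a , b , x , y) = (a , b ∸ suc a , x + suc y , y)
  shear₂⁻¹ (a , b , x , y) = (a , b + suc a , x ∸ suc y , y)

  shear₁-bijection : PartialBijection (Rep ∩ B<A) (Rep ∩ X<Y)
  shear₁-bijection = record
    { to = shear₁ ; from = shear₁⁻¹ ; to-∈ = to-∈ ; from-∈ = from-∈ ; from∘to = from∘to ; to∘from = to∘from }
    where
    to-∈ : ∀ {q} → (Rep ∩ B<A) q → (Rep ∩ X<Y) (shear₁ q)
    to-∈ {a , b , x , y} (rep , b<a) with c , refl ← m≤n⇒∃[o]m+o≡n b<a rewrite m+n∸m≡n (suc b) c =
      trans (sym (rep≡ b c x y)) rep , m<m+n x z<s
      where
      rep≡ : ∀ b c x y → suc (suc b + c) * suc x + suc b * suc y ≡ suc c * suc x + suc b * suc (x + suc y)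
      rep≡ = solve-∀
    from-∈ : ∀ {q} → (Rep ∩ X<Y) q → (Rep ∩ B<A) (shear₁⁻¹ q)
    from-∈ {a , b , x , y} (rep , x<y) with d , refl ← m≤n⇒∃[o]m+o≡n x<y rewrite m+n∸m≡n (suc x) d =
      trans (rep≡ a b x d) rep , m≤n+m (suc b) a
      where
      rep≡ : ∀ a b x d → suc (a + suc b) * suc x + suc b * suc d ≡ suc a * suc x + suc b * suc (suc x + d)
      rep≡ = solve-∀
    from∘to : ∀ {q} → (Rep ∩ B<A) q → shear₁⁻¹ (shear₁ q) ≡ q
    from∘to {a , b , x , y} (_ , b<a) with c , refl ← m≤n⇒∃[o]m+o≡n b<a
      rewrite m+n∸m≡n (suc b) c | +-suc x y | m+n∸m≡n x y = cong (_, b , x , y) (+-comm c (suc b))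
    to∘from : ∀ {q} → (Rep ∩ X<Y) q → shear₁ (shear₁⁻¹ q) ≡ q
    to∘from {a , b , x , y} (_ , x<y) with d , refl ← m≤n⇒∃[o]m+o≡n x<y
      rewrite m+n∸m≡n (suc x) d | m+n∸n≡m a (suc b) = cong (λ t → a , b , x , t) (+-suc x d)

  shear₂-bijection : PartialBijection (Rep ∩ A<B) (Rep ∩ Y<X)
  shear₂-bijection = record
    { to = shear₂ ; from = shear₂⁻¹ ; to-∈ = to-∈ ; from-∈ = from-∈ ; from∘to = from∘to ; to∘from = to∘from }
    where
    to-∈ : ∀ {q} → (Rep ∩ A<B) q → (Rep ∩ Y<X) (shear₂ q)
    to-∈ {a , b , x , y} (rep , a<b) with c , refl ← m≤n⇒∃[o]m+o≡n a<b rewrite m+n∸m≡n (suc a) c =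
      trans (sym (rep≡ a c x y)) rep , subst (y <_) (sym (+-suc x y)) (s≤s (m≤n+m y x))
      where
      rep≡ : ∀ a c x y → suc a * suc x + suc (suc a + c) * suc y ≡ suc a * suc (x + suc y) + suc c * suc y
      rep≡ = solve-∀
    from-∈ : ∀ {q} → (Rep ∩ Y<X) q → (Rep ∩ A<B) (shear₂⁻¹ q)
    from-∈ {a , b , x , y} (rep , y<x) with d , refl ← m≤n⇒∃[o]m+o≡n y<x rewrite m+n∸m≡n (suc y) d =
      trans (rep≡ a b y d) rep , m≤n+m (suc a) b
      where
      rep≡ : ∀ a b y d → suc a * suc d + suc (b + suc a) * suc y ≡ suc a * suc (suc y + d) + suc b * suc y
      rep≡ = solve-∀
    from∘to : ∀ {q} → (Rep ∩ A<B) q → shear₂⁻¹ (shear₂ q) ≡ q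
    from∘to {a , b , x , y} (_ , a<b) with c , refl ← m≤n⇒∃[o]m+o≡n a<b
      rewrite m+n∸m≡n (suc a) c | m+n∸n≡m x (suc y) = cong (λ t → a , t , x , y) (+-comm c (suc a))
    to∘from : ∀ {q} → (Rep ∩ Y<X) q → shear₂ (shear₂⁻¹ q) ≡ q
    to∘from {a , b , x , y} (_ , y<x) with d , refl ← m≤n⇒∃[o]m+o≡n y<x
      rewrite m+n∸m≡n (suc y) d | m+n∸n≡m b (suc a) = cong (λ t → a , b , t , y) (+-comm d (suc y))

  ∑Quad-along : {P Q : Pred Quad 0ℓ} (P? : Decidable P) (Q? : Decidable Q) → P ⊆ Rep → Q ⊆ Rep →
    (b : PartialBijection P Q) (f h : Quad → ℕ) → (∀ {q} → P q → f q ≡ f (PartialBijection.to b q) + 2 * h q) →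
    ∑Quad P? f ≡ ∑Quad Q? f + 2 * ∑Quad P? h
  ∑Quad-along P? Q? P⊆Rep Q⊆Rep b f h step = begin
    ∑Quad P? f                                 ≡⟨ ∑-[]·-cong qs P? step ⟩
    ∑Quad P? (λ q → f (to q) + 2 * h q)        ≡⟨ ∑-[]·-+ qs P? (f ∘ to) (λ q → 2 * h q) ⟩
    ∑Quad P? (f ∘ to) + ∑Quad P? (λ q → 2 * h q)
      ≡⟨ cong₂ _+_ (∑-reindex (quads n) (quads n) P? Q? (Rep⊆Inside ∘ P⊆Rep) (Rep⊆Inside ∘ Q⊆Rep) b _ f (λ _ → refl))
                   (∑-[]·-*ˡ qs P? 2 h) ⟩
    ∑Quad Q? f + 2 * ∑Quad P? h                ∎
    where
    open ≡-Reasoning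
    open PartialBijection b using (to)
    qs : List Quad
    qs = elements (quads n)

  ∑Quad-B<A : ∑Quad (rep? ∩? b<a?) qab ≡ ∑Quad (rep? ∩? x<y?) qab + 2 * ∑Quad (rep? ∩? b<a?) ab
  ∑Quad-B<A = ∑Quad-along (rep? ∩? b<a?) (rep? ∩? x<y?) proj₁ proj₁ shear₁-bijection qab ab shear-step
    where
    shear-step : ∀ {q} → (Rep ∩ B<A) q → qab q ≡ qab (shear₁ q) + 2 * ab q
    shear-step {a , b , x , y} (_ , b<a) with c , refl ← m≤n⇒∃[o]m+o≡n b<a rewrite m+n∸m≡n (suc b) c = identity b c
      where
      identity : ∀ b c → let A = suc (suc b + c); B = suc b; C = suc c in
                 A * A + A * B + B * B ≡ C * C + C * B + B * B + 2 * (A * B)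
      identity = solve-∀

  ∑Quad-A<B : ∑Quad (rep? ∩? a<b?) qab ≡ ∑Quad (rep? ∩? y<x?) qab + 2 * ∑Quad (rep? ∩? a<b?) ab
  ∑Quad-A<B = ∑Quad-along (rep? ∩? a<b?) (rep? ∩? y<x?) proj₁ proj₁ shear₂-bijection qab ab shear-step
    where
    shear-step : ∀ {q} → (Rep ∩ A<B) q → qab q ≡ qab (shear₂ q) + 2 * ab q
    shear-step {a , b , x , y} (_ , a<b) with c , refl ← m≤n⇒∃[o]m+o≡n a<b rewrite m+n∸m≡n (suc a) c = identity a c
      where
      identity : ∀ a c → let A = suc a; B = suc (suc a + c); C = suc c in
                 A * A + A * B + B * B ≡ A * A + A * C + C * C + 2 * (A * B)
      identity = solve-∀

  ∑Quad-A≡B : ∑Quad (rep? ∩? a≟b?) qab ≡ 3 * ∑Quad (rep? ∩? a≟b?) ab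
  ∑Quad-A≡B = trans (∑-[]·-cong (elements (quads n)) (rep? ∩? a≟b?) diagonal-step)
                    (∑-[]·-*ˡ (elements (quads n)) (rep? ∩? a≟b?) 3 ab)
    where
    diagonal-step : ∀ {q} → (Rep ∩ A≡B) q → qab q ≡ 3 * ab q
    diagonal-step {a , _ , _ , _} (_ , refl) = identity (suc a)
      where
      identity : ∀ A → A * A + A * A + A * A ≡ 3 * (A * A)
      identity = solve-∀

  -- Skoruppa's identity: the two shears match the off-diagonal parts of both sides.
  skoruppa : 2 * ∑Quad rep? ab + ∑Quad (rep? ∩? a≟b?) ab ≡ ∑Quad (rep? ∩? x≟y?) qab
  skoruppa = +-cancelˡ-≡ (u + v) _ _ (begin
    u + v + (2 * ∑Quad rep? ab + t)
      ≡⟨ cong (λ z → u + v + (2 * z + t)) (sym (∑-trichotomy qs rep? proj₁ (proj₁ ∘ proj₂) ab)) ⟩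
    u + v + (2 * (p + r + t) + t)
      ≡⟨ regroup u v p r t ⟩
    (v + 2 * p) + (u + 2 * r) + 3 * t
      ≡⟨ cong₂ _+_ (cong₂ _+_ (sym ∑Quad-B<A) (sym ∑Quad-A<B)) (sym ∑Quad-A≡B) ⟩
    ∑Quad (rep? ∩? b<a?) qab + ∑Quad (rep? ∩? a<b?) qab + ∑Quad (rep? ∩? a≟b?) qab
      ≡⟨ ∑-trichotomy qs rep? proj₁ (proj₁ ∘ proj₂) qab ⟩
    ∑Quad rep? qab
      ≡⟨ ∑-trichotomy qs rep? (proj₁ ∘ proj₂ ∘ proj₂) (proj₂ ∘ proj₂ ∘ proj₂) qab ⟨
    u + v + ∑Quad (rep? ∩? x≟y?) qab ∎)
    where
    open ≡-Reasoning
    qs : List Quad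
    u v p r t : ℕ
    qs = elements (quads n)
    u = ∑Quad (rep? ∩? y<x?) qab
    v = ∑Quad (rep? ∩? x<y?) qab
    p = ∑Quad (rep? ∩? b<a?) ab
    r = ∑Quad (rep? ∩? a<b?) ab
    t = ∑Quad (rep? ∩? a≟b?) ab
    regroup : ∀ u v p r t → u + v + (2 * (p + r + t) + t) ≡ (v + 2 * p) + (u + 2 * r) + 3 * t
    regroup = solve-∀

  Fact : Pred (ℕ × ℕ) 0ℓ
  Fact (h , m) = suc h * suc m ≡ n

  fact? : Decidable Fact
  fact? (h , m) = suc h * suc m ≟ n

  pairs : Enumeration (ℕ × ℕ)
  pairs = downFromₑ n ×ₑ downFromₑ n

  Fact⊆Inside : Fact ⊆ Inside pairs
  Fact⊆Inside {h , m} hm≡n = ≤-trans (m≤m*n (suc h) (suc m)) (≤-reflexive hm≡n)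
                           , ≤-trans (m≤n*m (suc m) (suc h)) (≤-reflexive hm≡n)

  ∑Fact : (ℕ × ℕ → ℕ) → ℕ
  ∑Fact f = ∑[ p ← elements pairs ] [ fact? p ]· f p

  ∑Fact-swap : (f : ℕ × ℕ → ℕ) → ∑Fact f ≡ ∑Fact (f ∘ swap)
  ∑Fact-swap f = ∑-reindex-from pairs pairs fact? fact? Fact⊆Inside Fact⊆Inside swap-bijection f
    where
    swap-bijection : PartialBijection Fact Fact
    swap-bijection = record
      { to = swap ; from = swap ; to-∈ = λ {(h , m)} hm≡n → trans (*-comm (suc m) (suc h)) hm≡n
      ; from-∈ = λ {(h , m)} hm≡n → trans (*-comm (suc m) (suc h)) hm≡n
      ; from∘to = λ _ → refl ; to∘from = λ _ → refl }

  σ₁ σ₂ σ₃ : ℕ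
  σ₁ = ∑Fact (λ (h , _) → suc h)
  σ₂ = ∑Fact (λ (h , _) → suc h * suc h)
  σ₃ = ∑Fact (λ (h , _) → suc h * suc h * suc h)

  triples : Enumeration Triple
  triples = downFromₑ n ×ₑ downFromₑ n ×ₑ downFromₑ n

  Splitting : Pred Triple 0ℓ
  Splitting (h , m , u) = Fact (h , m) × u < m

  splitting? : Decidable Splitting
  splitting? (h , m , u) = fact? (h , m) ×-dec u <? m

  Splitting⊆Inside : Splitting ⊆ Inside triples
  Splitting⊆Inside (hm≡n , u<m) = let h<n , m<n = Fact⊆Inside hm≡n in h<n , m<n , <-trans u<m m<n

  ∑-splittings : (f : Triple → ℕ) →
    ∑[ t ← elements triples ] [ splitting? t ]· f t ≡ ∑Fact (λ (h , m) → ∑[ u ← downFrom m ] f (h , m , u))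
  ∑-splittings f = begin
    (∑[ t ← elements triples ] [ splitting? t ]· f t)
      ≡⟨ ∑-cartesianProduct ns (cartesianProduct ns ns) _ ⟩
    (∑[ h ← ns ] ∑[ p ← cartesianProduct ns ns ] [ splitting? (h , p) ]· f (h , p))
      ≡⟨ ∑-cong ns (λ h → trans (∑-cartesianProduct ns ns _) (∑-cong ns (λ m → along-u h m))) ⟩
    (∑[ h ← ns ] ∑[ m ← ns ] [ fact? (h , m) ]· (∑[ u ← downFrom m ] f (h , m , u)))
      ≡⟨ ∑-cartesianProduct ns ns _ ⟨
    ∑Fact (λ (h , m) → ∑[ u ← downFrom m ] f (h , m , u)) ∎
    where
    open ≡-Reasoning
    ns : List ℕ
    ns = downFrom n
    along-u : ∀ h m → ∑[ u ← ns ] [ splitting? (h , m , u) ]· f (h , m , u) ≡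
                      [ fact? (h , m) ]· (∑[ u ← downFrom m ] f (h , m , u))
    along-u h m = begin
      (∑[ u ← ns ] [ fact? (h , m) ×-dec u <? m ]· f (h , m , u))
        ≡⟨ ∑-cong ns (λ u → []·-×-dec (fact? (h , m)) (u <? m) _) ⟩
      (∑[ u ← ns ] [ fact? (h , m) ]· [ u <? m ]· f (h , m , u))
        ≡⟨ []·-∑ (fact? (h , m)) ns _ ⟨
      [ fact? (h , m) ]· (∑[ u ← ns ] [ u <? m ]· f (h , m , u))
        ≡⟨ []·-cong (fact? (h , m)) (λ hm≡n → ∑-downFrom-<-truncate n m _ (<⇒≤ (proj₂ (Fact⊆Inside {h , m} hm≡n)))) ⟩
      [ fact? (h , m) ]· (∑[ u ← downFrom m ] f (h , m , u)) ∎

  diagonal-bijection : PartialBijection (Rep ∩ A≡B) Splitting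
  diagonal-bijection = record
    { to = to ; from = from ; to-∈ = to-∈ ; from-∈ = from-∈ ; from∘to = from∘to ; to∘from = to∘from }
    where
    to : Quad → Triple
    to (a , _ , x , y) = (a , x + suc y , x)
    from : Triple → Quad
    from (h , m , u) = (h , h , u , m ∸ suc u)
    to-∈ : ∀ {q} → (Rep ∩ A≡B) q → Splitting (to q)
    to-∈ {a , _ , x , y} (rep , refl) = trans (identity a x y) rep , m<m+n x z<s
      where
      identity : ∀ a x y → suc a * suc (x + suc y) ≡ suc a * suc x + suc a * suc y
      identity = solve-∀
    from-∈ : ∀ {t} → Splitting t → (Rep ∩ A≡B) (from t)
    from-∈ {h , m , u} (hm≡n , u<m) with d , refl ← m≤n⇒∃[o]m+o≡n u<m rewrite m+n∸m≡n (suc u) d =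
      trans (identity h u d) hm≡n , refl
      where
      identity : ∀ h u d → suc h * suc u + suc h * suc d ≡ suc h * suc (suc u + d)
      identity = solve-∀
    from∘to : ∀ {q} → (Rep ∩ A≡B) q → from (to q) ≡ q
    from∘to {a , _ , x , y} (_ , refl) rewrite +-suc x y | m+n∸m≡n x y = refl
    to∘from : ∀ {t} → Splitting t → to (from t) ≡ t
    to∘from {h , m , u} (_ , u<m) with d , refl ← m≤n⇒∃[o]m+o≡n u<m rewrite m+n∸m≡n (suc u) d =
      cong (λ t → h , t , u) (+-suc u d)

  cross-bijection : PartialBijection (Rep ∩ X≡Y) Splitting
  cross-bijection = record
    { to = to ; from = from ; to-∈ = to-∈ ; from-∈ = from-∈ ; from∘to = from∘to ; to∘from = to∘from }
    where
    to : Quad → Triple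
    to (a , b , x , _) = (x , a + suc b , a)
    from : Triple → Quad
    from (h , m , u) = (u , m ∸ suc u , h , h)
    to-∈ : ∀ {q} → (Rep ∩ X≡Y) q → Splitting (to q)
    to-∈ {a , b , x , _} (rep , refl) = trans (identity a b x) rep , m<m+n a z<s
      where
      identity : ∀ a b x → suc x * suc (a + suc b) ≡ suc a * suc x + suc b * suc x
      identity = solve-∀
    from-∈ : ∀ {t} → Splitting t → (Rep ∩ X≡Y) (from t)
    from-∈ {h , m , u} (hm≡n , u<m) with d , refl ← m≤n⇒∃[o]m+o≡n u<m rewrite m+n∸m≡n (suc u) d =
      trans (identity h u d) hm≡n , refl
      where
      identity : ∀ h u d → suc u * suc h + suc d * suc h ≡ suc h * suc (suc u + d)
      identity = solve-∀
    from∘to : ∀ {q} → (Rep ∩ X≡Y) q → from (to q) ≡ q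
    from∘to {a , b , x , _} (_ , refl) rewrite +-suc a b | m+n∸m≡n a b = refl
    to∘from : ∀ {t} → Splitting t → to (from t) ≡ t
    to∘from {h , m , u} (_ , u<m) with d , refl ← m≤n⇒∃[o]m+o≡n u<m rewrite m+n∸m≡n (suc u) d =
      cong (λ t → h , t , u) (+-suc u d)

  ∑Quad-A≡B-ab : ∑Quad (rep? ∩? a≟b?) ab + σ₂ ≡ n * σ₁
  ∑Quad-A≡B-ab = begin
    ∑Quad (rep? ∩? a≟b?) ab + σ₂
      ≡⟨ cong (_+ σ₂) (∑-reindex-from (quads n) triples (rep? ∩? a≟b?) splitting? (Rep⊆Inside ∘ proj₁)
                          Splitting⊆Inside diagonal-bijection ab) ⟩
    (∑[ t ← elements triples ] [ splitting? t ]· suc (proj₁ t) * suc (proj₁ t)) + σ₂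
      ≡⟨ cong (_+ σ₂) (∑-splittings _) ⟩
    ∑Fact (λ (h , m) → ∑[ _ ← downFrom m ] suc h * suc h) + σ₂
      ≡⟨ cong (_+ σ₂) (∑-[]·-cong ps fact? λ { {h , m} _ → ∑-downFrom-const m (suc h * suc h) }) ⟩
    ∑Fact (λ (h , m) → m * (suc h * suc h)) + σ₂
      ≡⟨ ∑-[]·-+ ps fact? _ _ ⟨
    ∑Fact (λ (h , m) → m * (suc h * suc h) + suc h * suc h)
      ≡⟨ ∑-[]·-cong ps fact? (λ { {h , m} hm≡n → trans (identity h m) (cong (_* suc h) hm≡n) }) ⟩
    ∑Fact (λ (h , _) → n * suc h)
      ≡⟨ ∑-[]·-*ˡ ps fact? n _ ⟩
    n * σ₁ ∎
    where
    open ≡-Reasoning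
    ps : List (ℕ × ℕ)
    ps = elements pairs
    identity : ∀ h m → m * (suc h * suc h) + suc h * suc h ≡ suc h * suc m * suc h
    identity = solve-∀

  ∑Quad-X≡Y : 6 * ∑Quad (rep? ∩? x≟y?) qab + 6 * σ₂ ≡ 5 * σ₃ + σ₁
  ∑Quad-X≡Y = begin
    6 * ∑Quad (rep? ∩? x≟y?) qab + 6 * σ₂
      ≡⟨ cong₂ (λ s t → 6 * s + 6 * t) cross-sum (∑Fact-swap _) ⟩
    6 * ∑Fact (λ (_ , m) → w m) + 6 * ∑Fact (λ (_ , m) → suc m * suc m)
      ≡⟨ cong₂ _+_ (∑-[]·-*ˡ ps fact? 6 _) (∑-[]·-*ˡ ps fact? 6 _) ⟨
    ∑Fact (λ (_ , m) → 6 * w m) + ∑Fact (λ (_ , m) → 6 * (suc m * suc m))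
      ≡⟨ ∑-[]·-+ ps fact? _ _ ⟨
    ∑Fact (λ (_ , m) → 6 * w m + 6 * (suc m * suc m))
      ≡⟨ ∑-[]·-cong ps fact? (λ { {_ , m} _ → 6*∑quadratic m }) ⟩
    ∑Fact (λ (_ , m) → 5 * (suc m * suc m * suc m) + suc m)
      ≡⟨ ∑-[]·-+ ps fact? _ _ ⟩
    ∑Fact (λ (_ , m) → 5 * (suc m * suc m * suc m)) + ∑Fact (λ (_ , m) → suc m)
      ≡⟨ cong₂ _+_ (trans (∑-[]·-*ˡ ps fact? 5 _) (cong (5 *_) (sym (∑Fact-swap _)))) (sym (∑Fact-swap _)) ⟩
    5 * σ₃ + σ₁ ∎
    where
    open ≡-Reasoning
    ps : List (ℕ × ℕ)
    ps = elements pairs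
    w : ℕ → ℕ
    w m = ∑[ u ← downFrom m ] quadratic (suc u) (m ∸ u)
    cross-sum : ∑Quad (rep? ∩? x≟y?) qab ≡ ∑Fact (λ (_ , m) → w m)
    cross-sum = begin
      ∑Quad (rep? ∩? x≟y?) qab
        ≡⟨ ∑-reindex-from (quads n) triples (rep? ∩? x≟y?) splitting? (Rep⊆Inside ∘ proj₁)
                          Splitting⊆Inside cross-bijection qab ⟩
      (∑[ t ← elements triples ] [ splitting? t ]· qab (PartialBijection.from cross-bijection t))
        ≡⟨ ∑-splittings _ ⟩
      ∑Fact (λ (_ , m) → ∑[ u ← downFrom m ] quadratic (suc u) (suc (m ∸ suc u)))
        ≡⟨ ∑-[]·-cong ps fact? (λ { {_ , m} _ →
             ∑-downFrom-cong m (λ {u} u<m → cong (quadratic (suc u)) (sym (+-∸-assoc 1 u<m))) }) ⟩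
      ∑Fact (λ (_ , m) → w m) ∎

  ∑ab-identity : 12 * ∑Quad rep? ab + 6 * (n * σ₁) ≡ 5 * σ₃ + σ₁
  ∑ab-identity = begin
    12 * t + 6 * (n * σ₁)                   ≡⟨ cong (λ z → 12 * t + 6 * z) ∑Quad-A≡B-ab ⟨
    12 * t + 6 * (∑Quad (rep? ∩? a≟b?) ab + σ₂) ≡⟨ regroup t _ σ₂ ⟩
    6 * (2 * t + ∑Quad (rep? ∩? a≟b?) ab) + 6 * σ₂ ≡⟨ cong (λ z → 6 * z + 6 * σ₂) skoruppa ⟩
    6 * ∑Quad (rep? ∩? x≟y?) qab + 6 * σ₂   ≡⟨ ∑Quad-X≡Y ⟩
    5 * σ₃ + σ₁                             ∎
    where
    open ≡-Reasoning
    t : ℕ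
    t = ∑Quad rep? ab
    regroup : ∀ t d s → 12 * t + 6 * (d + s) ≡ 6 * (2 * t + d) + 6 * s
    regroup = solve-∀

  ∑Quad-ab≡ay : ∑Quad rep? ab ≡ ∑Quad rep? ay
  ∑Quad-ab≡ay = ∑-reindex-from (quads n) (quads n) rep? rep? Rep⊆Inside Rep⊆Inside flip-bijection ab
    where
    flip : Quad → Quad
    flip (a , b , x , y) = (a , y , x , b)
    flip-∈ : ∀ {q} → Rep q → Rep (flip q)
    flip-∈ {a , b , x , y} rep = trans (cong (suc a * suc x +_) (*-comm (suc y) (suc b))) rep
    flip-bijection : PartialBijection Rep Rep
    flip-bijection = record
      { to = flip ; from = flip ; to-∈ = λ {q} → flip-∈ {q} ; from-∈ = λ {q} → flip-∈ {q}
      ; from∘to = λ _ → refl ; to∘from = λ _ → refl }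

  cofactor-nonZero : ∀ {t} → Splitting t → let (_ , m , u) = t in NonZero (suc u * (m ∸ u))
  cofactor-nonZero {_ , m , u} (_ , u<m) = m*n≢0 (suc u) (m ∸ u) {{_}} {{≢-nonZero (m>n⇒m∸n≢0 u<m)}}

  cofactor≤n² : ∀ {t} → Splitting t → let (_ , m , u) = t in suc u * (m ∸ u) ≤ n * n
  cofactor≤n² {h , m , u} (hm≡n , u<m) = let _ , m<n = Fact⊆Inside {h , m} hm≡n in
    *-mono-≤ (<-trans u<m m<n) (≤-trans (m∸n≤m m u) (<⇒≤ m<n))

  Divisor : Pred (Triple × ℕ) 0ℓ
  Divisor ((h , m , u) , d) = Splitting (h , m , u) × suc d ∣ suc u * (m ∸ u)

  divisor? : Decidable Divisor
  divisor? ((h , m , u) , d) = splitting? (h , m , u) ×-dec suc d ∣? suc u * (m ∸ u)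

  divisor-data : Enumeration (Triple × ℕ)
  divisor-data = triples ×ₑ downFromₑ (n * n)

  Divisor⊆Inside : Divisor ⊆ Inside divisor-data
  Divisor⊆Inside {t , _} (split , d∣) =
    Splitting⊆Inside {t} split , ≤-trans (∣⇒≤ {{cofactor-nonZero {t} split}} d∣) (cofactor≤n² {t} split)

  gcd-bijection : PartialBijection Rep Divisor
  gcd-bijection = record
    { to = to ; from = from ; to-∈ = λ {q} → to-∈ {q} ; from-∈ = λ {t} → from-∈ {t}
    ; from∘to = λ {q} → from∘to {q} ; to∘from = λ {t} → to∘from {t} }
    where
    to : Quad → Triple × ℕ
    to q = lower₃₁ (Φ (raise₄ q))
    from : Triple × ℕ → Quad
    from t = lower₄ (Ψ (raise₃₁ t))
    RepValues : Pred Quad 0ℓ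
    RepValues (A , B , X , Y) = A * X + B * Y ≡ n
    DivisorValues : Pred (Triple × ℕ) 0ℓ
    DivisorValues ((H , M , U) , D) = H * M ≡ n × U < M × D ∣ U * (M ∸ U)
    divisor-lower : ∀ t → DivisorValues (raise₃₁ t) → Divisor t
    divisor-lower _ (hm≡n , s≤s u<m , d∣) = (hm≡n , u<m) , d∣
    to-∈ : ∀ {q} → Rep q → Divisor (to q)
    to-∈ {a , b , x , y} rep = divisor-lower (to (a , b , x , y))
      (subst DivisorValues (sym (Φ-positive {suc a} {suc b} {suc x} {suc y}))
        (trans (Φ-product {suc a} {suc b} {suc x} {suc y}) rep
        , Φ-< {suc a} {suc b} {suc x} {suc y} , Φ-∣ {suc a} {suc b} {suc x} {suc y}))
    from-∈ : ∀ {t} → Divisor t → Rep (from t)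
    from-∈ {(h , m , u) , d} ((hm≡n , u<m) , d∣) =
      subst RepValues (sym (Ψ-positive {suc h} {suc m} {suc u} {suc d} (s≤s u<m) d∣))
        (trans (Ψ-product {suc h} {suc m} {suc u} {suc d} (s≤s u<m) d∣) hm≡n)
    from∘to : ∀ {q} → Rep q → from (to q) ≡ q
    from∘to {a , b , x , y} _ =
      trans (cong (lower₄ ∘ Ψ) (Φ-positive {suc a} {suc b} {suc x} {suc y})) (cong lower₄ Ψ∘Φ)
    to∘from : ∀ {t} → Divisor t → to (from t) ≡ t
    to∘from {(h , m , u) , d} ((_ , u<m) , d∣) =
      trans (cong (lower₃₁ ∘ Φ) (Ψ-positive {suc h} {suc m} {suc u} {suc d} (s≤s u<m) d∣))
            (cong lower₃₁ (Φ∘Ψ {suc h} {suc m} {suc u} {suc d} (s≤s u<m) d∣))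

  ∑Quad-ay : ∑Quad rep? ay ≡ ∑Fact (λ (h , m) → suc h * S (suc m))
  ∑Quad-ay = begin
    ∑Quad rep? ay
      ≡⟨ ∑-reindex (quads n) divisor-data rep? divisor? Rep⊆Inside (λ {t} → Divisor⊆Inside {t}) gcd-bijection
                   ay w (λ {q} → w∘to {q}) ⟩
    (∑[ s ← elements divisor-data ] [ divisor? s ]· w s)
      ≡⟨ ∑-cartesianProduct (elements triples) (downFrom (n * n)) _ ⟩
    (∑[ t ← elements triples ] ∑[ d ← downFrom (n * n) ] [ divisor? (t , d) ]· w (t , d))
      ≡⟨ ∑-cong (elements triples) sum-over-divisors ⟩
    (∑[ t ← elements triples ] [ splitting? t ]· (suc (proj₁ t) * σ (cofactor t)))
      ≡⟨ ∑-splittings _ ⟩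
    ∑Fact (λ (h , m) → ∑[ u ← downFrom m ] suc h * σ (suc u * (m ∸ u)))
      ≡⟨ ∑-[]·-cong (elements pairs) fact? (λ { {h , m} _ →
           trans (∑-*ˡ (downFrom m) (suc h) _) (cong (suc h *_) (sym (S≡∑ m))) }) ⟩
    ∑Fact (λ (h , m) → suc h * S (suc m)) ∎
    where
    open ≡-Reasoning
    w : Triple × ℕ → ℕ
    w ((h , _ , _) , d) = suc h * suc d
    cofactor : Triple → ℕ
    cofactor (_ , m , u) = suc u * (m ∸ u)
    w∘to : ∀ {q} → Rep q → w (PartialBijection.to gcd-bijection q) ≡ ay q
    w∘to {a , b , x , y} _ = begin
      w (lower₃₁ (Φ (suc a , suc b , suc x , suc y)))
        ≡⟨ cong (λ ((H , _ , _) , D) → H * D) (Φ-positive {suc a} {suc b} {suc x} {suc y}) ⟩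
      gcd (suc x) (suc y) * (suc a * reduceʳ (suc x) (suc y))
        ≡⟨ *-left-swap (gcd (suc x) (suc y)) (suc a) _ ⟩
      suc a * (gcd (suc x) (suc y) * reduceʳ (suc x) (suc y))
        ≡⟨ cong (suc a *_) (gcd*reduceʳ (suc x) (suc y)) ⟩
      suc a * suc y ∎
    sum-over-divisors : ∀ t → ∑[ d ← downFrom (n * n) ] [ divisor? (t , d) ]· w (t , d) ≡
                              [ splitting? t ]· (suc (proj₁ t) * σ (cofactor t))
    sum-over-divisors t@(h , m , u) = begin
      (∑[ d ← downFrom (n * n) ] [ splitting? t ×-dec suc d ∣? cofactor t ]· (suc h * suc d))
        ≡⟨ ∑-cong (downFrom (n * n)) (λ d → []·-×-dec (splitting? t) (suc d ∣? cofactor t) _) ⟩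
      (∑[ d ← downFrom (n * n) ] [ splitting? t ]· [ suc d ∣? cofactor t ]· (suc h * suc d))
        ≡⟨ []·-∑ (splitting? t) (downFrom (n * n)) _ ⟨
      [ splitting? t ]· (∑[ d ← downFrom (n * n) ] [ suc d ∣? cofactor t ]· (suc h * suc d))
        ≡⟨ []·-cong (splitting? t) (λ split → begin
             (∑[ d ← downFrom (n * n) ] [ suc d ∣? cofactor t ]· (suc h * suc d))
               ≡⟨ ∑-cong (downFrom (n * n)) (λ d → []·-* (suc d ∣? cofactor t) (suc h) (suc d)) ⟩
             (∑[ d ← downFrom (n * n) ] suc h * ([ suc d ∣? cofactor t ]· suc d))
               ≡⟨ ∑-*ˡ (downFrom (n * n)) (suc h) _ ⟩
             suc h * (∑[ d ← downFrom (n * n) ] [ suc d ∣? cofactor t ]· suc d)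
               ≡⟨ cong (suc h *_) (σ≡∑ (cofactor t) (n * n) {{cofactor-nonZero {t} split}} (cofactor≤n² {t} split)) ⟨
             suc h * σ (cofactor t) ∎) ⟩
      [ splitting? t ]· (suc h * σ (cofactor t)) ∎

  ∑Fact-closedForm : ∑Fact (λ (h , m) → suc h * closedForm (suc m)) + 2 * σ₁ ≡ 2 * (n * σ₁)
  ∑Fact-closedForm = begin
    ∑Fact (λ (h , m) → suc h * closedForm (suc m)) + 2 * σ₁
      ≡⟨ cong (∑Fact _ +_) (∑-[]·-*ˡ ps fact? 2 _) ⟨
    ∑Fact (λ (h , m) → suc h * closedForm (suc m)) + ∑Fact (λ (h , _) → 2 * suc h)
      ≡⟨ ∑-[]·-+ ps fact? _ _ ⟨
    ∑Fact (λ (h , m) → suc h * closedForm (suc m) + 2 * suc h)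
      ≡⟨ ∑-[]·-cong ps fact? (λ { {h , m} hm≡n → trans (identity h m) (cong (λ z → 2 * (z * suc m)) hm≡n) }) ⟩
    ∑Fact (λ (_ , m) → 2 * (n * suc m))
      ≡⟨ trans (∑-[]·-*ˡ ps fact? 2 _) (cong (2 *_) (∑-[]·-*ˡ ps fact? n _)) ⟩
    2 * (n * ∑Fact (λ (_ , m) → suc m))
      ≡⟨ cong (λ z → 2 * (n * z)) (∑Fact-swap _) ⟨
    2 * (n * σ₁) ∎
    where
    open ≡-Reasoning
    ps : List (ℕ × ℕ)
    ps = elements pairs
    identity : ∀ h m → suc h * (2 * (m + m * suc m)) + 2 * suc h ≡ 2 * (suc h * suc m * suc m)
    identity = solve-∀

module _ (k : ℕ) where
  open Representations (suc k)

  ∑Fact-top-mod : (q : ℕ) (f g : ℕ → ℕ) → (∀ {m} → suc m < suc k → f (suc m) ≡ g (suc m) mod q) →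
    ∑Fact (λ (h , m) → suc h * f (suc m)) + g (suc k) ≡ ∑Fact (λ (h , m) → suc h * g (suc m)) + f (suc k) mod q
  ∑Fact-top-mod q f g f≡g = begin
    ∑Fact F + g (suc k)
      ≡⟨ cong (∑Fact F +_) (∑-δ pairs top-inside (g (suc k))) ⟨
    ∑Fact F + (∑[ p ← ps ] [ decEq pairs p (0 , k) ]· g (suc k))
      ≡⟨ ∑-+ ps (λ p → [ fact? p ]· F p) (λ p → [ decEq pairs p (0 , k) ]· g (suc k)) ⟨
    (∑[ p ← ps ] [ fact? p ]· F p + [ decEq pairs p (0 , k) ]· g (suc k))
      ≈⟨ ∑-mod-cong ps pointwise ⟩
    (∑[ p ← ps ] [ fact? p ]· G p + [ decEq pairs p (0 , k) ]· f (suc k))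
      ≡⟨ ∑-+ ps (λ p → [ fact? p ]· G p) (λ p → [ decEq pairs p (0 , k) ]· f (suc k)) ⟩
    ∑Fact G + (∑[ p ← ps ] [ decEq pairs p (0 , k) ]· f (suc k))
      ≡⟨ cong (∑Fact G +_) (∑-δ pairs top-inside (f (suc k))) ⟩
    ∑Fact G + f (suc k) ∎
    where
    open import Relation.Binary.Reasoning.Setoid (≡-mod-setoid {q})
    ps : List (ℕ × ℕ)
    ps = elements pairs
    F G : ℕ × ℕ → ℕ
    F (h , m) = suc h * f (suc m)
    G (h , m) = suc h * g (suc m)
    top-inside : Inside pairs (0 , k)
    top-inside = z<s , n<1+n k
    pointwise : ∀ p → [ fact? p ]· F p + [ decEq pairs p (0 , k) ]· g (suc k) ≡
                      [ fact? p ]· G p + [ decEq pairs p (0 , k) ]· f (suc k) mod q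
    pointwise (zero , m) with fact? (zero , m) | decEq pairs (zero , m) (zero , k)
    ... | yes _ | yes refl = ≡⇒≡-mod (identity (f (suc k)) (g (suc k)))
      where
      identity : ∀ x y → 1 * x + y ≡ 1 * y + x
      identity = solve-∀
    ... | yes hm≡n | no ≢top = ⊥-elim (≢top (cong (zero ,_) (suc-injective (trans (sym (+-identityʳ (suc m))) hm≡n))))
    ... | no ¬fact | yes refl = ⊥-elim (¬fact (+-identityʳ (suc k)))
    ... | no _ | no _ = ≡⇒≡-mod refl
    pointwise (suc h , m) with fact? (suc h , m)
    ... | yes hm≡n = +-mod-cong (*-mod-congˡ (suc (suc h)) (f≡g (subst (suc m <_) hm≡n (m<m+n (suc m) z<s))))
                                (≡⇒≡-mod refl)
    ... | no _ = ≡⇒≡-mod refl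

  -- 3 is the inverse of 12 modulo 5, and all multiples of 5 drop out.
  S≡closedForm-step : (∀ {m} → m < k → S (suc m) ≡ closedForm (suc m) mod 5) → S (suc k) ≡ closedForm (suc k) mod 5
  S≡closedForm-step IH = *-mod-cancelˡ 12 3 7 refl (begin
    12 * X                                   ≈⟨ ≡-mod-sym (+-*-mod (12 * X) (6 * w)) ⟩
    12 * X + 6 * w * 5                       ≡⟨ regroup₁ X w ⟩
    12 * X + 12 * (2 * w) + 6 * w            ≡⟨ cong (λ z → 12 * X + 12 * z + 6 * w) ∑Fact-closedForm ⟨
    12 * X + 12 * (Uᶻ + 2 * σ₁) + 6 * w      ≡⟨ regroup₂ X Uᶻ σ₁ w ⟩
    12 * (Uᶻ + X) + (24 * σ₁ + 6 * w)        ≈⟨ +-mod-cong (*-mod-congˡ 12 (≡-mod-sym top)) (≡⇒≡-mod refl) ⟩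
    12 * (Uˢ + Z) + (24 * σ₁ + 6 * w)        ≡⟨ regroup₃ Uˢ Z σ₁ w ⟩
    12 * Z + 24 * σ₁ + (12 * Uˢ + 6 * w)     ≡⟨ cong (λ z → 12 * Z + 24 * σ₁ + (12 * z + 6 * w)) T≡Uˢ ⟨
    12 * Z + 24 * σ₁ + (12 * ∑Quad rep? ab + 6 * w) ≡⟨ cong (12 * Z + 24 * σ₁ +_) ∑ab-identity ⟩
    12 * Z + 24 * σ₁ + (5 * σ₃ + σ₁)         ≡⟨ regroup₄ Z σ₁ σ₃ ⟩
    12 * Z + (σ₃ + 5 * σ₁) * 5               ≈⟨ +-*-mod (12 * Z) (σ₃ + 5 * σ₁) ⟩
    12 * Z                                   ∎)
    where
    open import Relation.Binary.Reasoning.Setoid (≡-mod-setoid {5})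
    X Z w Uˢ Uᶻ : ℕ
    X = S (suc k)
    Z = closedForm (suc k)
    w = suc k * σ₁
    Uˢ = ∑Fact (λ (h , m) → suc h * S (suc m))
    Uᶻ = ∑Fact (λ (h , m) → suc h * closedForm (suc m))
    T≡Uˢ : ∑Quad rep? ab ≡ Uˢ
    T≡Uˢ = trans ∑Quad-ab≡ay ∑Quad-ay
    top : Uˢ + Z ≡ Uᶻ + X mod 5
    top = ∑Fact-top-mod 5 S closedForm (λ m<k → IH (≤-pred m<k))
    regroup₁ : ∀ X w → 12 * X + 6 * w * 5 ≡ 12 * X + 12 * (2 * w) + 6 * w
    regroup₁ = solve-∀
    regroup₂ : ∀ X U s w → 12 * X + 12 * (U + 2 * s) + 6 * w ≡ 12 * (U + X) + (24 * s + 6 * w)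
    regroup₂ = solve-∀
    regroup₃ : ∀ U Z s w → 12 * (U + Z) + (24 * s + 6 * w) ≡ 12 * Z + 24 * s + (12 * U + 6 * w)
    regroup₃ = solve-∀
    regroup₄ : ∀ Z s t → 12 * Z + 24 * s + (5 * t + s) ≡ 12 * Z + (t + 5 * s) * 5
    regroup₄ = solve-∀

S≡closedForm : ∀ k → S (suc k) ≡ closedForm (suc k) mod 5
S≡closedForm = <-rec _ S≡closedForm-step

proposition5p4 : (n : ℕ) → 1 ≤ n → S n % 5 ≡ (2 * (n * n ∸ 1)) % 5
proposition5p4 (suc k) _ = ≡-mod⇒%≡ (S≡closedForm k)
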